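{- Let $\alpha>0$ be sufficiently small, and let $D$ be a directed graph on $2n$ vertices which is not $\alpha$-extremal. Then for all $A,B\subseteq V(D)$ with $(1-\alpha/2)n\le |A|,|B|\le(1+\alpha/2)n$ we have $\vec{e}(A,B)\ge \frac{\alpha^2}{2}n^2$.
   Context: Directed graphs are loopless, with $E(D)\subseteq V(D)\times V(D)$. For $A,B\subseteq V(D)$, $\vec{e}(A,B)$ is the number of edges $(u,v)\in E(D)$ with $u\in A$, $v\in B$ ($A,B$ may intersect). $\Delta^+(A,B)=\max_{a\in A}|N^+(a)\cap B|$ and $\Delta^-(B,A)=\max_{b\in B}|N^-(b)\cap A|$. A directed graph $D$ on $2n$ vertices is $\alpha$-extremal if there exist $A,B\subseteq V(D)$ with $(1-\alpha)n\le|A|,|B|\le(1+\alpha)n$, $\Delta^+(A,B)\le\alpha n$ and $\Delta^-(B,A)\le\alpha n$.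
   Formalization: The parameter α ranges over the positive rationals, and the threshold below which α counts as sufficiently small is likewise rational. -}

module Defs where

open import Data.Nat using (ℕ; _*_)
open import Data.Integer using (+_)
open import Data.Rational using (ℚ; _/_; 1ℚ; ½) renaming (_≤_ to _≤ℚ_; _*_ to _*ℚ_; _-_ to _-ℚ_; _+_ to _+ℚ_)
open import Data.Fin using (Fin)
open import Data.Fin.Subset using (Subset; _∈_; ∣_∣)
open import Data.Vec using (lookup)
open import Data.Bool using (Bool; true; false; _∧_; if_then_else_)
open import Data.List using (map; allFin)
open import Data.Nat.ListAction using (sum)
open import Data.Product using (Σ; _×_)
open import Relation.Binary.PropositionalEquality using (_≡_)

toℚ : ℕ → ℚ
toℚ k = (+ k) / 1

record Digraph (m : ℕ) : Set where
  field
    edge     : Fin m → Fin m → Bool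
    loopless : ∀ v → edge v v ≡ false
open Digraph public

[_] : Bool → ℕ
[ b ] = if b then 1 else 0

Σ[_] : ∀ {m} → (Fin m → ℕ) → ℕ
Σ[_] {m} f = sum (map f (allFin m))

eDir : ∀ {m} → Digraph m → Subset m → Subset m → ℕ
eDir D A B = Σ[ (λ u → Σ[ (λ v → [ lookup A u ∧ lookup B v ∧ edge D u v ]) ]) ]

outDegInto : ∀ {m} → Digraph m → Fin m → Subset m → ℕ
outDegInto D a B = Σ[ (λ v → [ lookup B v ∧ edge D a v ]) ]

inDegFrom : ∀ {m} → Digraph m → Fin m → Subset m → ℕ
inDegFrom D b A = Σ[ (λ u → [ lookup A u ∧ edge D u b ]) ]

SizeBound : ∀ {m} → ℚ → ℕ → Subset m → Set
SizeBound β n A = ((1ℚ -ℚ β) *ℚ toℚ n ≤ℚ toℚ ∣ A ∣) × (toℚ ∣ A ∣ ≤ℚ (1ℚ +ℚ β) *ℚ toℚ n)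

Extremal : ℚ → (n : ℕ) → Digraph (2 * n) → Set
Extremal α n D = Σ (Subset (2 * n)) λ A → Σ (Subset (2 * n)) λ B →
    SizeBound α n A × SizeBound α n B
  × (∀ a → a ∈ A → toℚ (outDegInto D a B) ≤ℚ α *ℚ toℚ n)
  × (∀ b → b ∈ B → toℚ (inDegFrom D b A) ≤ℚ α *ℚ toℚ n)

-- Suppose e(A,B) < (α²/2)n² for some A, B of size (1 ± α/2)n. Let A' ⊆ A be the
-- vertices with at most αn out-neighbours in B, and B' ⊆ B those with at most αn
-- in-neighbours in A. Every vertex of A ∖ A' contributes more than αn edges to
-- e(A,B), so |A ∖ A'| · αn ≤ e(A,B) < (αn/2) · αn, i.e. fewer than αn/2 vertices
-- are discarded; likewise for B. Hence A', B' have size (1 ± α)n, and since degrees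
-- only drop when passing to subsets, the pair (A', B') shows that D is α-extremal.
module Submission where

open import Defs
open import Data.Bool using (true; false; _∧_)
open import Data.Bool.Properties using (∧-commutativeMonoid)
open import Data.Fin using (Fin; zero; suc)
open import Data.Fin.Subset using (Subset; _∈_; _⊆_; _∩_; ∁; ∣_∣)
open import Data.Fin.Subset.Properties using (x∈p∩q⁻; p∩q⊆p; x∈∁p⇒x∉p)
import Data.Integer as ℤ
open ℤ using (+_)
import Data.Integer.Properties as ℤ
open import Data.List using (List; []; _∷_; map; allFin)
open import Data.List.Properties using (map-tabulate; map-cong)
import Data.Nat as ℕ
open ℕ using (ℕ; _*_; z≤n)
import Data.Nat.Properties as ℕ
open import Data.Nat.Coprimality using (1-coprimeTo) renaming (sym to coprime-sym)
open import Data.Nat.ListAction using (sum)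
open import Data.Product using (Σ; _×_; _,_; proj₂)
open import Data.Rational
  using (ℚ; 0ℚ; 1ℚ; ½; mkℚ; _/_; _<_; _≤_; *≤*; _+_; _-_; NonNegative; nonNegative)
  renaming (_*_ to _*ℚ_)
import Data.Rational.Properties as ℚ
open import Data.Rational.Solver using (module +-*-Solver)
open import Data.Vec using ([]; _∷_; lookup; tabulate; here; there)
open import Data.Vec.Properties using (lookup∘tabulate; []=⇒lookup; lookup⇒[]=)
open import Function using (_∘_; id)
open import Relation.Binary.PropositionalEquality hiding ([_])
open import Relation.Nullary using (¬_; yes; no; does)
open import Relation.Nullary.Decidable using (dec-true)
open import Relation.Unary using (Pred; Decidable)
open import Algebra.Bundles using (CommutativeMonoid)
import Algebra.Properties.CommutativeSemigroup as CommutativeSemigroupProperties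

module ℕ+ = CommutativeSemigroupProperties ℕ.+-commutativeSemigroup
module 𝔹∧ = CommutativeSemigroupProperties (CommutativeMonoid.commutativeSemigroup ∧-commutativeMonoid)

toℚ≡mkℚ : ∀ k → toℚ k ≡ mkℚ (+ k) 0 (coprime-sym (1-coprimeTo k))
toℚ≡mkℚ k = ℚ.normalize-coprime _

toℚ-+ : ∀ a b → toℚ (a ℕ.+ b) ≡ toℚ a + toℚ b
toℚ-+ a b rewrite toℚ≡mkℚ a | toℚ≡mkℚ b =
  cong (_/ 1) (sym (cong₂ ℤ._+_ (ℤ.*-identityʳ (+ a)) (ℤ.*-identityʳ (+ b))))

toℚ-mono-≤ : ∀ {a b} → a ℕ.≤ b → toℚ a ≤ toℚ b
toℚ-mono-≤ {a} {b} a≤b rewrite toℚ≡mkℚ a | toℚ≡mkℚ b =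
  *≤* (ℤ.*-monoʳ-≤-nonNeg (+ 1) (ℤ.+≤+ a≤b))

toℚ-nonNeg : ∀ k → 0ℚ ≤ toℚ k
toℚ-nonNeg k = toℚ-mono-≤ {0} {k} z≤n

sum-map-+ : ∀ {a} {A : Set a} (f g : A → ℕ) (xs : List A) →
            sum (map (λ x → f x ℕ.+ g x) xs) ≡ sum (map f xs) ℕ.+ sum (map g xs)
sum-map-+ f g []       = refl
sum-map-+ f g (x ∷ xs) =
  trans (cong (f x ℕ.+ g x ℕ.+_) (sum-map-+ f g xs)) (ℕ+.interchange (f x) (g x) _ _)

sum-map-zero : ∀ {a} {A : Set a} (xs : List A) → sum (map (λ _ → 0) xs) ≡ 0
sum-map-zero []       = refl
sum-map-zero (_ ∷ xs) = sum-map-zero xs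

sum-map-swap : ∀ {a b} {A : Set a} {B : Set b} (f : A → B → ℕ) (xs : List A) (ys : List B) →
               sum (map (λ x → sum (map (f x) ys)) xs) ≡ sum (map (λ y → sum (map (λ x → f x y) xs)) ys)
sum-map-swap f []       ys = sym (sum-map-zero ys)
sum-map-swap f (x ∷ xs) ys =
  trans (cong (sum (map (f x) ys) ℕ.+_) (sum-map-swap f xs ys))
        (sym (sum-map-+ (f x) (λ y → sum (map (λ x′ → f x′ y) xs)) ys))

sum-map-mono : ∀ {a} {A : Set a} {f g : A → ℕ} → (∀ x → f x ℕ.≤ g x) →
               (xs : List A) → sum (map f xs) ℕ.≤ sum (map g xs)
sum-map-mono f≤g []       = z≤n
sum-map-mono f≤g (x ∷ xs) = ℕ.+-mono-≤ (f≤g x) (sum-map-mono f≤g xs)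

Σ-cong : ∀ {m} {f g : Fin m → ℕ} → (∀ i → f i ≡ g i) → Σ[ f ] ≡ Σ[ g ]
Σ-cong {m} f≗g = cong sum (map-cong f≗g (allFin m))

Σ-suc : ∀ {m} (f : Fin (ℕ.suc m) → ℕ) → Σ[ f ] ≡ f zero ℕ.+ Σ[ f ∘ suc ]
Σ-suc f = cong (λ xs → f zero ℕ.+ sum xs)
               (trans (map-tabulate suc f) (sym (map-tabulate id (f ∘ suc))))

toℚ-Σ-suc : ∀ {m} (f : Fin (ℕ.suc m) → ℕ) → toℚ Σ[ f ] ≡ toℚ (f zero) + toℚ Σ[ f ∘ suc ]
toℚ-Σ-suc f = trans (cong toℚ (Σ-suc f)) (toℚ-+ (f zero) _)

∣p∣≡∣p∩q∣+∣p∩∁q∣ : ∀ {m} (p q : Subset m) → ∣ p ∣ ≡ ∣ p ∩ q ∣ ℕ.+ ∣ p ∩ ∁ q ∣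
∣p∣≡∣p∩q∣+∣p∩∁q∣ []          []          = refl
∣p∣≡∣p∩q∣+∣p∩∁q∣ (false ∷ p) (_ ∷ q)     = ∣p∣≡∣p∩q∣+∣p∩∁q∣ p q
∣p∣≡∣p∩q∣+∣p∩∁q∣ (true ∷ p)  (true ∷ q)  = cong ℕ.suc (∣p∣≡∣p∩q∣+∣p∩∁q∣ p q)
∣p∣≡∣p∩q∣+∣p∩∁q∣ (true ∷ p)  (false ∷ q) =
  trans (cong ℕ.suc (∣p∣≡∣p∩q∣+∣p∩∁q∣ p q)) (sym (ℕ.+-suc _ _))

∣p∣*t≤Σh : ∀ {m} {t : ℚ} (p : Subset m) (h : Fin m → ℕ) →
           (∀ i → i ∈ p → t ≤ toℚ (h i)) → toℚ ∣ p ∣ *ℚ t ≤ toℚ Σ[ h ]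
∣p∣*t≤Σh {t = t} [] h _ = ℚ.≤-reflexive (ℚ.*-zeroˡ t)
∣p∣*t≤Σh {t = t} (true ∷ p) h h≥t = begin
  toℚ (1 ℕ.+ ∣ p ∣) *ℚ t            ≡⟨ cong (_*ℚ t) (toℚ-+ 1 ∣ p ∣) ⟩
  (1ℚ + toℚ ∣ p ∣) *ℚ t             ≡⟨ ℚ.*-distribʳ-+ t 1ℚ (toℚ ∣ p ∣) ⟩
  1ℚ *ℚ t + toℚ ∣ p ∣ *ℚ t          ≡⟨ cong (_+ toℚ ∣ p ∣ *ℚ t) (ℚ.*-identityˡ t) ⟩
  t + toℚ ∣ p ∣ *ℚ t                ≤⟨ ℚ.+-mono-≤ (h≥t zero here) (∣p∣*t≤Σh p (h ∘ suc) (λ i → h≥t (suc i) ∘ there)) ⟩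
  toℚ (h zero) + toℚ Σ[ h ∘ suc ]   ≡⟨ toℚ-Σ-suc h ⟨
  toℚ Σ[ h ]                        ∎
  where open ℚ.≤-Reasoning
∣p∣*t≤Σh {t = t} (false ∷ p) h h≥t = begin
  toℚ ∣ p ∣ *ℚ t                    ≡⟨ ℚ.+-identityˡ _ ⟨
  0ℚ + toℚ ∣ p ∣ *ℚ t               ≤⟨ ℚ.+-mono-≤ (toℚ-nonNeg (h zero)) (∣p∣*t≤Σh p (h ∘ suc) (λ i → h≥t (suc i) ∘ there)) ⟩
  toℚ (h zero) + toℚ Σ[ h ∘ suc ]   ≡⟨ toℚ-Σ-suc h ⟨
  toℚ Σ[ h ]                        ∎
  where open ℚ.≤-Reasoning

fromDecidable : ∀ {m ℓ} {P : Pred (Fin m) ℓ} → Decidable P → Subset m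
fromDecidable P? = tabulate (does ∘ P?)

∈-fromDecidable⁺ : ∀ {m ℓ} {P : Pred (Fin m) ℓ} (P? : Decidable P) {i} → P i → i ∈ fromDecidable P?
∈-fromDecidable⁺ P? {i} p = lookup⇒[]= i _ (trans (lookup∘tabulate (does ∘ P?) i) (dec-true (P? i) p))

∈-fromDecidable⁻ : ∀ {m ℓ} {P : Pred (Fin m) ℓ} (P? : Decidable P) {i} → i ∈ fromDecidable P? → P i
∈-fromDecidable⁻ P? {i} i∈ with P? i | trans (sym (lookup∘tabulate (does ∘ P?) i)) ([]=⇒lookup i∈)
... | yes p | _  = p
... | no _  | ()

-- inDegFrom D b A is definitionally outDegInto (converse D) b A, so every statement
-- about out-degrees also yields its in-degree counterpart.
converse : ∀ {m} → Digraph m → Digraph m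
converse D = record { edge = λ u v → edge D v u ; loopless = loopless D }

eDir-converse : ∀ {m} (D : Digraph m) (A B : Subset m) → eDir (converse D) B A ≡ eDir D A B
eDir-converse {m} D A B = begin
  eDir (converse D) B A
    ≡⟨ Σ-cong (λ u → Σ-cong (λ v → cong [_] (𝔹∧.x∙yz≈y∙xz (lookup B u) (lookup A v) (edge D v u)))) ⟩
  Σ[ (λ u → Σ[ (λ v → [ lookup A v ∧ lookup B u ∧ edge D v u ]) ]) ]
    ≡⟨ sum-map-swap (λ u v → [ lookup A u ∧ lookup B v ∧ edge D u v ]) (allFin m) (allFin m) ⟨
  eDir D A B ∎
  where open ≡-Reasoning

outDegInto-mono : ∀ {m} (D : Digraph m) (a : Fin m) {B′ B : Subset m} →
                  B′ ⊆ B → outDegInto D a B′ ℕ.≤ outDegInto D a B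
outDegInto-mono D a {B′} {B} B′⊆B = sum-map-mono pointwise (allFin _)
  where
  pointwise : ∀ v → [ lookup B′ v ∧ edge D a v ] ℕ.≤ [ lookup B v ∧ edge D a v ]
  pointwise v with lookup B′ v in v∈B′
  ... | false = z≤n
  ... | true rewrite []=⇒lookup (B′⊆B (lookup⇒[]= v B′ v∈B′)) = ℕ.≤-refl

lowOutDeg? : ∀ {m} (D : Digraph m) (t : ℚ) (B : Subset m) → Decidable (λ a → toℚ (outDegInto D a B) ≤ t)
lowOutDeg? D t B a = toℚ (outDegInto D a B) ℚ.≤? t

lowOutDeg : ∀ {m} → Digraph m → ℚ → Subset m → Subset m
lowOutDeg D t B = fromDecidable (lowOutDeg? D t B)

lowOutDeg-bound : ∀ {m} (D : Digraph m) {t : ℚ} {B B′ : Subset m} {a : Fin m} →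
                  a ∈ lowOutDeg D t B → B′ ⊆ B → toℚ (outDegInto D a B′) ≤ t
lowOutDeg-bound D {t} {B} {a = a} a∈L B′⊆B =
  ℚ.≤-trans (toℚ-mono-≤ (outDegInto-mono D a B′⊆B)) (∈-fromDecidable⁻ (lowOutDeg? D t B) a∈L)

highOutDeg-count : ∀ {m} (D : Digraph m) (t : ℚ) (A B : Subset m) →
                   toℚ ∣ A ∩ ∁ (lowOutDeg D t B) ∣ *ℚ t ≤ toℚ (eDir D A B)
highOutDeg-count D t A B = ∣p∣*t≤Σh (A ∩ ∁ L) _ high
  where
  L = lowOutDeg D t B
  high : ∀ u → u ∈ A ∩ ∁ L → t ≤ toℚ Σ[ (λ v → [ lookup A u ∧ lookup B v ∧ edge D u v ]) ]
  high u u∈ with x∈p∩q⁻ A (∁ L) u∈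
  ... | u∈A , u∈∁L rewrite []=⇒lookup u∈A =
    ℚ.<⇒≤ (ℚ.≰⇒> (x∈∁p⇒x∉p u∈∁L ∘ ∈-fromDecidable⁺ (lowOutDeg? D t B)))

SizeBound-shrink : ∀ {m} {β : ℚ} {n k : ℕ} {X Y : Subset m} → 0ℚ ≤ β →
                   ∣ X ∣ ≡ ∣ Y ∣ ℕ.+ k → toℚ k ≤ β *ℚ toℚ n →
                   SizeBound β n X → SizeBound (β + β) n Y
SizeBound-shrink {β = β} {n} {k} {X} {Y} 0≤β X≡Y+k k≤βn (lower , upper) = lower′ , upper′
  where
  open ℚ.≤-Reasoning
  open +-*-Solver
  N = toℚ n
  instance
    N-nonNeg : NonNegative N
    N-nonNeg = nonNegative (toℚ-nonNeg n)

  lower′ : (1ℚ - (β + β)) *ℚ N ≤ toℚ ∣ Y ∣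
  lower′ = begin
    (1ℚ - (β + β)) *ℚ N           ≡⟨ solve 2 (λ β N → (con 1ℚ :- (β :+ β)) :* N := (con 1ℚ :- β) :* N :- β :* N) refl β N ⟩
    (1ℚ - β) *ℚ N - β *ℚ N        ≤⟨ ℚ.+-mono-≤ lower (ℚ.neg-antimono-≤ k≤βn) ⟩
    toℚ ∣ X ∣ - toℚ k             ≡⟨ cong (_- toℚ k) (trans (cong toℚ X≡Y+k) (toℚ-+ ∣ Y ∣ k)) ⟩
    (toℚ ∣ Y ∣ + toℚ k) - toℚ k   ≡⟨ solve 2 (λ y k → (y :+ k) :- k := y) refl (toℚ ∣ Y ∣) (toℚ k) ⟩
    toℚ ∣ Y ∣                     ∎

  β≤β+β : β ≤ β + β
  β≤β+β = begin
    β      ≡⟨ ℚ.+-identityʳ β ⟨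
    β + 0ℚ ≤⟨ ℚ.+-monoʳ-≤ β 0≤β ⟩
    β + β  ∎

  upper′ : toℚ ∣ Y ∣ ≤ (1ℚ + (β + β)) *ℚ N
  upper′ = begin
    toℚ ∣ Y ∣           ≤⟨ toℚ-mono-≤ (subst (∣ Y ∣ ℕ.≤_) (sym X≡Y+k) (ℕ.m≤m+n ∣ Y ∣ k)) ⟩
    toℚ ∣ X ∣           ≤⟨ upper ⟩
    (1ℚ + β) *ℚ N       ≤⟨ ℚ.*-monoʳ-≤-nonNeg N (ℚ.+-monoʳ-≤ 1ℚ β≤β+β) ⟩
    (1ℚ + (β + β)) *ℚ N ∎

sparsePair⇒extremal : ∀ {α : ℚ} → 0ℚ ≤ α →
                      (n : ℕ) (D : Digraph (2 * n)) (A B : Subset (2 * n)) →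
                      SizeBound (α *ℚ ½) n A → SizeBound (α *ℚ ½) n B →
                      toℚ (eDir D A B) < (α *ℚ α *ℚ ½) *ℚ (toℚ n *ℚ toℚ n) →
                      Extremal α n D
sparsePair⇒extremal {α} 0≤α n D A B sizeA sizeB sparse =
  A ∩ Lᴬ , B ∩ Lᴮ ,
  shrink A Lᴬ sizeA (highOutDeg-count D t A B) ,
  shrink B Lᴮ sizeB highInDeg-count ,
  (λ a a∈ → lowOutDeg-bound D (proj₂ (x∈p∩q⁻ A Lᴬ a∈)) (p∩q⊆p B Lᴮ)) ,
  (λ b b∈ → lowOutDeg-bound (converse D) (proj₂ (x∈p∩q⁻ B Lᴮ b∈)) (p∩q⊆p A Lᴬ))
  where
  open +-*-Solver
  N = toℚ n
  t = α *ℚ N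
  E = toℚ (eDir D A B)
  Lᴬ = lowOutDeg D t B
  Lᴮ = lowOutDeg (converse D) t A

  instance
    α-nonNeg : NonNegative α
    α-nonNeg = nonNegative 0≤α
    N-nonNeg : NonNegative N
    N-nonNeg = nonNegative (toℚ-nonNeg n)
    t-nonNeg : NonNegative t
    t-nonNeg = ℚ.nonNeg*nonNeg⇒nonNeg α N

  α/2-nonNeg : 0ℚ ≤ α *ℚ ½
  α/2-nonNeg = ℚ.nonNegative⁻¹ (α *ℚ ½) {{ℚ.nonNeg*nonNeg⇒nonNeg α ½}}

  highInDeg-count : toℚ ∣ B ∩ ∁ Lᴮ ∣ *ℚ t ≤ E
  highInDeg-count = subst (λ e → toℚ ∣ B ∩ ∁ Lᴮ ∣ *ℚ t ≤ toℚ e)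
                          (eDir-converse D A B) (highOutDeg-count (converse D) t B A)

  discarded-bound : ∀ k → toℚ k *ℚ t ≤ E → toℚ k ≤ α *ℚ ½ *ℚ N
  discarded-bound k k*t≤E =
    ℚ.<⇒≤ (ℚ.*-cancelʳ-<-nonNeg t (ℚ.≤-<-trans k*t≤E (subst (E <_) square sparse)))
    where
    square : (α *ℚ α *ℚ ½) *ℚ (N *ℚ N) ≡ (α *ℚ ½ *ℚ N) *ℚ t
    square = solve 2 (λ α N → (α :* α :* con ½) :* (N :* N) := (α :* con ½ :* N) :* (α :* N))
                     refl α N

  shrink : ∀ X L → SizeBound (α *ℚ ½) n X → toℚ ∣ X ∩ ∁ L ∣ *ℚ t ≤ E → SizeBound α n (X ∩ L)
  shrink X L size X∖L-count =
    subst (λ β → SizeBound β n (X ∩ L)) (solve 1 (λ α → α :* con ½ :+ α :* con ½ := α) refl α)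
          (SizeBound-shrink {n = n} {X = X} {Y = X ∩ L} α/2-nonNeg (∣p∣≡∣p∩q∣+∣p∩∁q∣ X L)
                            (discarded-bound ∣ X ∩ ∁ L ∣ X∖L-count) size)

-- Any α₀ > 0 will do: the argument only uses 0 ≤ α.
mainTheorem5 : Σ ℚ λ α₀ → (0ℚ < α₀) × ((α : ℚ) → 0ℚ < α → α ≤ α₀ →
    (n : ℕ) (D : Digraph (2 * n)) → ¬ Extremal α n D →
    (A B : Subset (2 * n)) → SizeBound (α *ℚ ½) n A → SizeBound (α *ℚ ½) n B →
    (α *ℚ α *ℚ ½) *ℚ (toℚ n *ℚ toℚ n) ≤ toℚ (eDir D A B))
mainTheorem5 = 1ℚ , ℚ.positive⁻¹ 1ℚ , λ α 0<α _ n D notExtremal A B sizeA sizeB →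
  ℚ.≮⇒≥ (notExtremal ∘ sparsePair⇒extremal (ℚ.<⇒≤ 0<α) n D A B sizeA sizeB)
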